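{- $\underline{{\rm gp}}_{\rm S}(K_6,K_9)=25$.
   Context: $K_m$ is the complete graph on $m$ vertices. A set $X$ of vertices of a connected graph is a general position set if no shortest path contains more than two vertices of $X$; ${\rm gp}$ denotes the maximum cardinality of a general position set. For graphs $G,H$ and $f\colon V(G)\to V(H)$, the Sierpiński product $G\otimes_f H$ has vertex set $V(G)\times V(H)$ and edges $(g,h)(g,h')$ for $g\in V(G)$, $hh'\in E(H)$, and $(g,f(g'))(g',f(g))$ for $gg'\in E(G)$. $\underline{{\rm gp}}_{\rm S}(G,H)=\min_f{\rm gp}(G\otimes_f H)$ over all functions $f\colon V(G)\to V(H)$. -}

module Defs where

open import Data.Nat using (ℕ; zero; suc; _≤_)
open import Data.Fin using (Fin)
open import Data.List using (List; []; _∷_; length)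
open import Data.List.Membership.Propositional using (_∈_)
open import Data.List.Relation.Unary.Unique.Propositional using (Unique)
open import Data.Product using (Σ; _×_; _,_)
open import Data.Sum using (_⊎_)
open import Relation.Binary.PropositionalEquality using (_≡_; _≢_)
open import Relation.Nullary using (¬_)

data Walk {V : Set} (E : V → V → Set) : V → V → ℕ → Set where
  []  : ∀ {u} → Walk E u u 0
  _∷_ : ∀ {u v w n} → E u v → Walk E v w n → Walk E u w (suc n)

verts : ∀ {V : Set} {E : V → V → Set} {u v n} → Walk E u v n → List V
verts {u = u} []      = u ∷ []
verts {u = u} (_ ∷ w) = u ∷ verts w

IsShortest : ∀ {V : Set} (E : V → V → Set) {u v n} → Walk E u v n → Set
IsShortest E {u} {v} {n} _ = ∀ {m} → Walk E u v m → n ≤ m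

IsGeneralPosition : ∀ {V : Set} (E : V → V → Set) → List V → Set
IsGeneralPosition {V} E X =
  ∀ {u v n} (w : Walk E u v n) → IsShortest E w →
  ¬ (Σ V λ x → Σ V λ y → Σ V λ z →
       x ≢ y × x ≢ z × y ≢ z ×
       x ∈ X × y ∈ X × z ∈ X ×
       x ∈ verts w × y ∈ verts w × z ∈ verts w)

IsGp : ∀ {V : Set} (E : V → V → Set) → ℕ → Set
IsGp {V} E k =
  (Σ (List V) λ X → Unique X × IsGeneralPosition E X × length X ≡ k) ×
  (∀ (X : List V) → Unique X → IsGeneralPosition E X → length X ≤ k)

K : (m : ℕ) → Fin m → Fin m → Set
K m i j = i ≢ j

Sierpinski : ∀ {A B : Set} (GE : A → A → Set) (HE : B → B → Set) (f : A → B) →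
             A × B → A × B → Set
Sierpinski GE HE f (g , h) (g' , h') =
  (g ≡ g' × HE h h') ⊎ (GE g g' × h ≡ f g' × h' ≡ f g)

IsLowerGpS : ∀ {A B : Set} (GE : A → A → Set) (HE : B → B → Set) → ℕ → Set
IsLowerGpS {A} {B} GE HE k =
  (Σ (A → B) λ f → IsGp (Sierpinski GE HE f) k) ×
  (∀ (f : A → B) (k' : ℕ) → IsGp (Sierpinski GE HE f) k' → k ≤ k')

-- Call (g , h) an exit of copy g if h = f k for some copy k ≠ g, i.e. if (g , h) is
-- incident to an edge between copies.  Shortest paths in K₆ ⊗_f K₉ have length at most 3
-- and their interior vertices are exits, so the non-exits are in general position.  Copy g
-- has at most five exits, hence at least four non-exits; if f a = f b with a ≠ b, a copy
-- g₀ ∉ {a, b} has at most four exits, and there are 5 + 5·4 = 25 non-exits.  If f is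
-- injective, drop copy 0 and keep, in every other copy, the vertices that are not exits
-- towards a copy other than 0, five per copy.  Their edges between copies lead into
-- copy 0, and by injectivity a geodesic never uses two consecutive edges between copies,
-- so a geodesic (of length at most 3) meets these 25 vertices at most twice.
--
-- Conversely, for the inclusion ι : Fin 6 → Fin 9 let X be in general position and call a
-- copy big if it meets X at least twice.  If a big copy g contains the exit (g , ι g′),
-- say that g points to g′; then X meets copy g′ at most in (g′ , ι g), since otherwise a
-- geodesic (g , u) (g , ι g′) (g′ , ι g) (g′ , v) contains three vertices of X.  So a
-- pointed copy is not big, and it is empty if two copies point to it.  A big copy meets X
-- in at most 4 + (number of copies it points to) vertices, and double counting the
-- pointers gives |X| ≤ 4k + (6 − k)·max(2, k) ≤ 25 for k big copies.

module Submission where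

open import Data.Bool using (true; false; if_then_else_)
open import Data.Empty using (⊥; ⊥-elim)
open import Data.Fin using (Fin; zero; suc; toℕ; fromℕ<; punchIn; _↑ˡ_; _↑ʳ_)
open import Data.Fin.Properties using (_≟_; any?; all?; toℕ-fromℕ<; ↑ˡ-injective)
open import Data.List using (List; []; _∷_; _++_; length; filter; tabulate; allFin; map; cartesianProduct)
open import Data.List.Properties using (length-++; length-++-sucʳ; filter-++; map-tabulate)
open import Data.List.Membership.Propositional using (_∈_)
open import Data.List.Membership.Propositional.Properties
  using (∈-++⁻; ∈-++⁺ˡ; ∈-++⁺ʳ; ∈-∃++; ∈-allFin; ∈-cartesianProduct⁺; ∈-filter⁺; ∈-filter⁻)
open import Data.List.Relation.Unary.All as All using (All; []; _∷_)
import Data.List.Relation.Unary.All.Properties as All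
open import Data.List.Relation.Unary.AllPairs using (_∷_)
open import Data.List.Relation.Unary.Any using (here; there)
open import Data.List.Relation.Unary.Unique.Propositional using (Unique)
open import Data.List.Relation.Unary.Unique.Propositional.Properties using (cartesianProduct⁺; allFin⁺; filter⁺)
open import Data.Nat using (ℕ; zero; suc; _+_; _*_; _∸_; _⊔_; _≤_; _<_; z≤n; s≤s; s≤s⁻¹)
open import Data.Nat.Properties
  using (_≤?_; ≤-refl; ≤-reflexive; ≤-trans; ≤-antisym; ≤-pred; n≤1+n; 1+n≰n; n≮0; <⇒≱; ≰⇒>;
         +-assoc; +-comm; *-identityˡ; +-mono-≤; +-monoˡ-≤; +-monoʳ-≤; ∸-monoʳ-≤;
         m≤m+n; m+n∸n≡m; m≤m⊔n; m≤n⊔m; +-*-semiring; module ≤-Reasoning)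
open import Data.Product using (∃; ∃₂; _×_; _,_; proj₁; proj₂)
open import Data.Product.Properties using (≡-dec)
open import Data.Sum using (_⊎_; inj₁; inj₂; [_,_]′)
open import Data.Vec.Functional using (removeAt)
open import Function using (_∘_; Injective)
open import Level using (Level)
open import Relation.Binary.PropositionalEquality
open import Relation.Nullary using (Dec; yes; no; does; ¬_; ¬?)
open import Relation.Nullary.Decidable using (_×-dec_; from-yes)
open import Relation.Unary using (Pred; Decidable; _⊆_; ∁; _∩_)
open import Relation.Unary.Properties using (∁?; _∩?_)

open import Algebra.Properties.Semiring.Sum +-*-semiring
  using (sum; sum-syntax; sum-cong-≗; sum-remove; sum-replicate-zero; ∑-distrib-+; ∑-comm;
         *-distribˡ-sum; *-distribʳ-sum)

open import Defs

private variable
  a b p q : Level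
  A : Set a
  B : Set b
  m n : ℕ

-- Counting on Fin n

-- Defined through `does`, so that for instance 𝟙 (suc i ≟ suc j) reduces to 𝟙 (i ≟ j).
𝟙 : Dec A → ℕ
𝟙 d = if does d then 1 else 0

𝟙≤1 : (d : Dec A) → 𝟙 d ≤ 1
𝟙≤1 (yes _) = ≤-refl
𝟙≤1 (no _)  = z≤n

𝟙-mono : (d : Dec A) (e : Dec B) → (A → B) → 𝟙 d ≤ 𝟙 e
𝟙-mono (yes _) (yes _) _   = ≤-refl
𝟙-mono (yes x) (no ¬y) A→B = ⊥-elim (¬y (A→B x))
𝟙-mono (no _)  _       _   = z≤n

𝟙-yes : (d : Dec A) → A → 𝟙 d ≡ 1
𝟙-yes (yes _) _ = refl
𝟙-yes (no ¬x) x = ⊥-elim (¬x x)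

𝟙-no : (d : Dec A) → ¬ A → 𝟙 d ≡ 0
𝟙-no (yes x) ¬x = ⊥-elim (¬x x)
𝟙-no (no _)  _  = refl

𝟙-¬?+𝟙≡1 : (d : Dec A) → 𝟙 (¬? d) + 𝟙 d ≡ 1
𝟙-¬?+𝟙≡1 (yes _) = refl
𝟙-¬?+𝟙≡1 (no _)  = refl

𝟙-split : (d : Dec A) (e : Dec B) → 𝟙 e ≤ 𝟙 d + 𝟙 (¬? d ×-dec e)
𝟙-split (yes _) e = 𝟙≤1 e
𝟙-split (no _)  e = ≤-refl

sum-mono-≤ : {φ ψ : Fin n → ℕ} → (∀ i → φ i ≤ ψ i) → sum φ ≤ sum ψ
sum-mono-≤ {zero}  _   = z≤n
sum-mono-≤ {suc n} φ≤ψ = +-mono-≤ (φ≤ψ zero) (sum-mono-≤ (φ≤ψ ∘ suc))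

sum-ones : {φ : Fin n → ℕ} → (∀ i → φ i ≡ 1) → sum φ ≡ n
sum-ones {zero}  _   = refl
sum-ones {suc n} φ≡1 = cong₂ _+_ (φ≡1 zero) (sum-ones (φ≡1 ∘ suc))

term≤sum : (φ : Fin n → ℕ) (i : Fin n) → φ i ≤ sum φ
term≤sum {suc n} φ i = ≤-trans (m≤m+n _ _) (≤-reflexive (sym (sum-remove {i = i} φ)))

sum-↑ : ∀ m {n} (φ : Fin (m + n) → ℕ) → sum φ ≡ ∑[ i < m ] φ (i ↑ˡ n) + ∑[ j < n ] φ (m ↑ʳ j)
sum-↑ zero    φ = refl
sum-↑ (suc m) φ = trans (cong (φ zero +_) (sum-↑ m (φ ∘ suc))) (sym (+-assoc (φ zero) _ _))

count : {P : Pred (Fin n) p} → Decidable P → ℕ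
count {n = n} P? = ∑[ i < n ] 𝟙 (P? i)

module _ {P : Pred (Fin n) p} (P? : Decidable P) where

  count≤n : count P? ≤ n
  count≤n = ≤-trans (sum-mono-≤ (λ i → 𝟙≤1 (P? i))) (≤-reflexive (sum-ones {n} (λ _ → refl)))

  count-none : (∀ i → ¬ P i) → count P? ≡ 0
  count-none ∄P = trans (sum-cong-≗ (λ i → 𝟙-no (P? i) (∄P i))) (sum-replicate-zero n)

  count-positive : ∀ {i} → P i → 0 < count P?
  count-positive {i} Pi = ≤-trans (≤-reflexive (sym (𝟙-yes (P? i) Pi))) (term≤sum (𝟙 ∘ P?) i)

  count-witness : 0 < count P? → ∃ P
  count-witness 0<count with any? P?
  ... | yes ∃P = ∃P
  ... | no  ∄P = ⊥-elim (n≮0 (subst (0 <_) (count-none (λ i Pi → ∄P (i , Pi))) 0<count))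

  count-∁ : count (∁? P?) ≡ n ∸ count P?
  count-∁ = begin
    count (∁? P?)                                 ≡⟨ m+n∸n≡m _ (count P?) ⟨
    count (∁? P?) + count P? ∸ count P?
      ≡⟨ cong (_∸ count P?) (∑-distrib-+ (𝟙 ∘ ∁? P?) (𝟙 ∘ P?)) ⟨
    ∑[ i < n ] (𝟙 (∁? P? i) + 𝟙 (P? i)) ∸ count P?
      ≡⟨ cong (_∸ count P?) (sum-ones {n} (𝟙-¬?+𝟙≡1 ∘ P?)) ⟩
    n ∸ count P?                                  ∎
    where open ≡-Reasoning

module _ {P : Pred (Fin n) p} {Q : Pred (Fin n) q} (P? : Decidable P) (Q? : Decidable Q) where

  count-mono : P ⊆ Q → count P? ≤ count Q?
  count-mono P⊆Q = sum-mono-≤ (λ i → 𝟙-mono (P? i) (Q? i) P⊆Q)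

count-<-mono : {P : Pred (Fin n) p} {Q : Pred (Fin n) q} (P? : Decidable P) (Q? : Decidable Q) →
               P ⊆ Q → ∀ {j} → Q j → ¬ P j → count P? < count Q?
count-<-mono {suc n} P? Q? P⊆Q {j} Qj ¬Pj = begin-strict
  count P?                              ≡⟨ sum-remove {i = j} (𝟙 ∘ P?) ⟩
  𝟙 (P? j) + sum (removeAt (𝟙 ∘ P?) j)  ≡⟨ cong (_+ sum (removeAt (𝟙 ∘ P?) j)) (𝟙-no (P? j) ¬Pj) ⟩
  sum (removeAt (𝟙 ∘ P?) j)             <⟨ s≤s (sum-mono-≤ (λ i → 𝟙-mono (P? _) (Q? (punchIn j i)) P⊆Q)) ⟩
  1 + sum (removeAt (𝟙 ∘ Q?) j)         ≡⟨ cong (_+ sum (removeAt (𝟙 ∘ Q?) j)) (𝟙-yes (Q? j) Qj) ⟨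
  𝟙 (Q? j) + sum (removeAt (𝟙 ∘ Q?) j)  ≡⟨ sum-remove {i = j} (𝟙 ∘ Q?) ⟨
  count Q?                              ∎
  where open ≤-Reasoning

count-≡ : (j : Fin n) → count (_≟ j) ≡ 1
count-≡ {suc n} zero    = cong suc (count-none {n = n} (λ i → suc i ≟ zero) (λ _ ()))
count-≡ {suc n} (suc j) = count-≡ j

count-≢ : (j : Fin (suc n)) → count (∁? (_≟ j)) ≡ n
count-≢ {n} j = trans (count-∁ (_≟ j)) (cong (suc n ∸_) (count-≡ j))

module _ {P : Pred (Fin n) p} (P? : Decidable P) where

  count≤1+count-≢ : ∀ j → count P? ≤ 1 + count (∁? (_≟ j) ∩? P?)
  count≤1+count-≢ j = begin
    count P?                                          ≤⟨ sum-mono-≤ (λ i → 𝟙-split (i ≟ j) (P? i)) ⟩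
    ∑[ i < n ] (𝟙 (i ≟ j) + 𝟙 ((∁? (_≟ j) ∩? P?) i))  ≡⟨ ∑-distrib-+ (𝟙 ∘ (_≟ j)) _ ⟩
    count (_≟ j) + count (∁? (_≟ j) ∩? P?)            ≡⟨ cong (_+ count (∁? (_≟ j) ∩? P?)) (count-≡ j) ⟩
    1 + count (∁? (_≟ j) ∩? P?)                       ∎
    where open ≤-Reasoning

  count≥2⇒∃≢ : 2 ≤ count P? → ∀ j → ∃ λ i → i ≢ j × P i
  count≥2⇒∃≢ 2≤count j =
    count-witness (∁? (_≟ j) ∩? P?) (s≤s⁻¹ (≤-trans 2≤count (count≤1+count-≢ j)))

  count-≤1 : (∀ {i j} → P i → P j → i ≡ j) → count P? ≤ 1
  count-≤1 unique with any? P?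
  ... | no  ∄P       = ≤-trans (≤-reflexive (count-none P? (λ i Pi → ∄P (i , Pi)))) z≤n
  ... | yes (j , Pj) = ≤-trans (count≤1+count-≢ j)
    (≤-reflexive (cong suc (count-none (∁? (_≟ j) ∩? P?) (λ i (i≢j , Pi) → i≢j (unique Pi Pj)))))

𝟙-any?≤count : {P : Pred (Fin n) p} (P? : Decidable P) → 𝟙 (any? P?) ≤ count P?
𝟙-any?≤count P? with any? P?
... | yes (_ , Pi) = count-positive P? Pi
... | no  _        = z≤n

Image : (Fin m → Fin n) → Pred (Fin m) p → Pred (Fin n) p
Image f P h = ∃ λ k → P k × f k ≡ h

image? : (f : Fin m → Fin n) {P : Pred (Fin m) p} → Decidable P → Decidable (Image f P)
image? f P? h = any? (λ k → P? k ×-dec (f k ≟ h))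

count-image : (f : Fin m → Fin n) {P : Pred (Fin m) p} (P? : Decidable P) → count (image? f P?) ≤ count P?
count-image {m} {n} f {P} P? = begin
  count (image? f P?)                             ≤⟨ sum-mono-≤ (λ h → 𝟙-any?≤count (image-witness? h)) ⟩
  ∑[ h < n ] ∑[ k < m ] 𝟙 (P? k ×-dec (f k ≟ h))  ≡⟨ ∑-comm (λ h k → 𝟙 (P? k ×-dec (f k ≟ h))) ⟩
  ∑[ k < m ] ∑[ h < n ] 𝟙 (P? k ×-dec (f k ≟ h))  ≤⟨ sum-mono-≤ (λ k → fibre (P? k)) ⟩
  count P?                                        ∎
  where
  open ≤-Reasoning
  image-witness? : ∀ h → Decidable (λ k → P k × f k ≡ h)
  image-witness? h k = P? k ×-dec (f k ≟ h)
  fibre : ∀ {k} (d : Dec (P k)) → count (λ h → d ×-dec (f k ≟ h)) ≤ 𝟙 d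
  fibre {k} d@(yes _)  = count-≤1 (λ h → d ×-dec (f k ≟ h)) (λ (_ , e) (_ , e′) → trans (sym e) e′)
  fibre {k} d@(no ¬Pk) = ≤-reflexive (count-none (λ h → d ×-dec (f k ≟ h)) (λ _ (Pk , _) → ¬Pk Pk))

avoid-two : (a b : Fin (3 + m)) → ∃ λ g → g ≢ b × g ≢ a
avoid-two a b = count≥2⇒∃≢ (∁? (_≟ a)) (≤-trans (s≤s (s≤s z≤n)) (≤-reflexive (sym (count-≢ a)))) b

unique-⊆⇒length≤ : {xs ys : List A} → Unique xs → (∀ {x} → x ∈ xs → x ∈ ys) → length xs ≤ length ys
unique-⊆⇒length≤ {xs = []}     _            _     = z≤n
unique-⊆⇒length≤ {xs = x ∷ xs} (x∉xs ∷ !xs) xs⊆ys with us , vs , refl ← ∈-∃++ (xs⊆ys (here refl)) =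
  ≤-trans (s≤s (unique-⊆⇒length≤ !xs skip-x)) (≤-reflexive (sym (length-++-sucʳ us x vs)))
  where
  skip-x : ∀ {y} → y ∈ xs → y ∈ us ++ vs
  skip-x {y} y∈xs with ∈-++⁻ us (xs⊆ys (there y∈xs))
  ... | inj₁ y∈us         = ∈-++⁺ˡ y∈us
  ... | inj₂ (here y≡x)   = ⊥-elim (All.lookup x∉xs y∈xs (sym y≡x))
  ... | inj₂ (there y∈vs) = ∈-++⁺ʳ us y∈vs

grid : List (Fin m × Fin n)
grid {m} {n} = cartesianProduct (allFin m) (allFin n)

grid-unique : Unique (grid {m} {n})
grid-unique {m} {n} = cartesianProduct⁺ (allFin⁺ m) (allFin⁺ n)

∈-grid : (x : Fin m × Fin n) → x ∈ grid
∈-grid (g , h) = ∈-cartesianProduct⁺ (∈-allFin g) (∈-allFin h)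

length-filter-tabulate : {P : Pred A p} (P? : Decidable P) (F : Fin n → A) →
                         length (filter P? (tabulate F)) ≡ ∑[ i < n ] 𝟙 (P? (F i))
length-filter-tabulate {n = zero}  P? F = refl
length-filter-tabulate {n = suc n} P? F with does (P? (F zero))
... | true  = cong suc (length-filter-tabulate P? (F ∘ suc))
... | false = length-filter-tabulate P? (F ∘ suc)

length-filter-grid : {P : Pred (Fin m × Fin n) p} (P? : Decidable P) →
                     length (filter P? grid) ≡ ∑[ g < m ] count (λ h → P? (g , h))
length-filter-grid {m} {n} P? = rows (λ g → g)
  where
  rows : ∀ {k} (F : Fin k → Fin m) →
         length (filter P? (cartesianProduct (tabulate F) (allFin n))) ≡ ∑[ i < k ] count (λ h → P? (F i , h))
  rows {zero}  F = refl
  rows {suc k} F = begin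
    length (filter P? (first ++ rest))                    ≡⟨ cong length (filter-++ P? first rest) ⟩
    length (filter P? first ++ filter P? rest)            ≡⟨ length-++ (filter P? first) ⟩
    length (filter P? first) + length (filter P? rest)
      ≡⟨ cong₂ _+_ (trans (cong (length ∘ filter P?) (map-tabulate (λ h → h) (F zero ,_)))
                          (length-filter-tabulate P? (F zero ,_)))
                   (rows (F ∘ suc)) ⟩
    count (λ h → P? (F zero , h)) + ∑[ i < k ] count (λ h → P? (F (suc i) , h))  ∎
    where
    open ≡-Reasoning
    first = map (F zero ,_) (allFin n)
    rest  = cartesianProduct (tabulate (F ∘ suc)) (allFin n)

-- General position and geodesics

AtMostTwo : {V : Set} → (V → Set) → List V → Set
AtMostTwo S xs = ∃₂ λ a b → All (λ x → S x → x ≡ a ⊎ x ≡ b) xs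

no-three-among-two : ∀ {x y z a b : A} → x ≢ y → x ≢ z → y ≢ z →
                     x ≡ a ⊎ x ≡ b → y ≡ a ⊎ y ≡ b → z ≡ a ⊎ z ≡ b → ⊥
no-three-among-two x≢y _   _   (inj₁ refl) (inj₁ refl) _           = x≢y refl
no-three-among-two x≢y _   _   (inj₂ refl) (inj₂ refl) _           = x≢y refl
no-three-among-two _   x≢z _   (inj₁ refl) (inj₂ refl) (inj₁ refl) = x≢z refl
no-three-among-two _   _   y≢z (inj₁ refl) (inj₂ refl) (inj₂ refl) = y≢z refl
no-three-among-two _   _   y≢z (inj₂ refl) (inj₁ refl) (inj₁ refl) = y≢z refl
no-three-among-two _   x≢z _   (inj₂ refl) (inj₁ refl) (inj₂ refl) = x≢z refl

atMostTwo⇒generalPosition : ∀ {V : Set} {E : V → V → Set} {S : V → Set} {X : List V} →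
  (∀ {u v n} (w : Walk E u v n) → IsShortest E w → AtMostTwo S (verts w)) →
  (∀ {x} → x ∈ X → S x) → IsGeneralPosition E X
atMostTwo⇒generalPosition {X = X} atMostTwo X⊆S w w-shortest
  (x , y , z , x≢y , x≢z , y≢z , x∈X , y∈X , z∈X , x∈w , y∈w , z∈w)
  with a , b , two ← atMostTwo w w-shortest =
  no-three-among-two x≢y x≢z y≢z (among x∈X x∈w) (among y∈X y∈w) (among z∈X z∈w)
  where
  among : ∀ {x} → x ∈ X → x ∈ verts w → x ≡ a ⊎ x ≡ b
  among x∈X x∈w = All.lookup two x∈w (X⊆S x∈X)

module Walks {V : Set} (E : V → V → Set) where

  _++ᵂ_ : ∀ {x y z k l} → Walk E x y k → Walk E y z l → Walk E x z (k + l)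
  []      ++ᵂ w′ = w′
  (e ∷ w) ++ᵂ w′ = e ∷ (w ++ᵂ w′)

  shortest-tail : ∀ {u v t n} (e : E u v) (w : Walk E v t n) → IsShortest E (e ∷ w) → IsShortest E w
  shortest-tail e _ e∷w-shortest w′ = ≤-pred (e∷w-shortest (e ∷ w′))

  no-shortcut : ∀ {a b c d n} (e₁ : E a b) (e₂ : E b c) (w : Walk E c d n) →
                IsShortest E (e₁ ∷ e₂ ∷ w) → ¬ (a ≡ c ⊎ E a c)
  no-shortcut _ _ w shortest (inj₁ refl) = 1+n≰n (≤-trans (n≤1+n _) (shortest w))
  no-shortcut _ _ w shortest (inj₂ e)    = 1+n≰n (shortest (e ∷ w))

module SierpinskiComplete {m n : ℕ} (f : Fin m → Fin n) where

  Vertex : Set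
  Vertex = Fin m × Fin n

  E : Vertex → Vertex → Set
  E = Sierpinski (K m) (K n) f

  open Walks E

  Inner Cross : Vertex → Vertex → Set
  Inner (g , h) (g′ , h′) = g ≡ g′ × h ≢ h′
  Cross (g , h) (g′ , h′) = g ≢ g′ × h ≡ f g′ × h′ ≡ f g

  Cross-sym : ∀ {x y} → Cross x y → Cross y x
  Cross-sym (g≢g′ , h≡fg′ , h′≡fg) = g≢g′ ∘ sym , h′≡fg , h≡fg′

  IsExit : Vertex → Set
  IsExit (g , h) = Image f (∁ (_≡ g)) h

  exit? : Decidable IsExit
  exit? (g , h) = image? f (∁? (_≟ g)) h

  cross⇒exit : ∀ {x y} → Cross x y → IsExit x
  cross⇒exit {y = g′ , _} (g≢g′ , h≡fg′ , _) = g′ , g≢g′ ∘ sym , sym h≡fg′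

  ExitAvoiding : Fin m → Vertex → Set
  ExitAvoiding c (g , h) = Image f (∁ (_≡ g) ∩ ∁ (_≡ c)) h

  exitAvoiding? : ∀ c → Decidable (ExitAvoiding c)
  exitAvoiding? c (g , h) = image? f (∁? (_≟ g) ∩? ∁? (_≟ c)) h

  ExitsOnlyTo : Fin m → Vertex → Set
  ExitsOnlyTo c (g , h) = g ≢ c × ¬ ExitAvoiding c (g , h)

  exitsOnlyTo? : ∀ c → Decidable (ExitsOnlyTo c)
  exitsOnlyTo? c (g , h) = ¬? (g ≟ c) ×-dec ∁? (exitAvoiding? c) (g , h)

  exitsOnlyTo-crosses-into : ∀ {c x y} → Cross x y → ExitsOnlyTo c x → proj₁ y ≡ c
  exitsOnlyTo-crosses-into {c} {y = g′ , _} (g≢g′ , h≡fg′ , _) (_ , ¬exit) with g′ ≟ c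
  ... | yes g′≡c = g′≡c
  ... | no  g′≢c = ⊥-elim (¬exit (g′ , (g≢g′ ∘ sym , g′≢c) , sym h≡fg′))

  inner-inner⇒shortcut : ∀ {x y z} → Inner x y → Inner y z → x ≡ z ⊎ E x z
  inner-inner⇒shortcut {_ , h} {z = _ , h″} (refl , _) (refl , _) with h ≟ h″
  ... | yes refl = inj₁ refl
  ... | no h≢h″  = inj₂ (inj₁ (refl , h≢h″))

  shortest⇒cross : ∀ {x y z t k} (e₁ : E x y) (e₂ : E y z) (w : Walk E z t k) →
                   IsShortest E (e₁ ∷ e₂ ∷ w) → Cross x y ⊎ Cross y z
  shortest⇒cross (inj₂ c)  _         _ _        = inj₁ c
  shortest⇒cross (inj₁ _)  (inj₂ c)  _ _        = inj₂ c
  shortest⇒cross (inj₁ i₁) (inj₁ i₂) w shortest =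
    ⊥-elim (no-shortcut (inj₁ i₁) (inj₁ i₂) w shortest (inner-inner⇒shortcut i₁ i₂))

  interior-exits : ∀ {x y z k} (e : E x y) (w : Walk E y z k) → IsShortest E (e ∷ w) →
                   All (λ v → IsExit v ⊎ v ≡ z) (verts w)
  interior-exits _ []       _        = inj₂ refl ∷ []
  interior-exits e (e′ ∷ w) shortest =
    inj₁ ([ cross⇒exit ∘ Cross-sym , cross⇒exit ]′ (shortest⇒cross e e′ w shortest))
    ∷ interior-exits e′ w (shortest-tail e (e′ ∷ w) shortest)

  nonExits-atMostTwo : ∀ {S : Vertex → Set} → (∀ {x} → S x → ¬ IsExit x) →
                       ∀ {x z k} (w : Walk E x z k) → IsShortest E w → AtMostTwo S (verts w)
  nonExits-atMostTwo _ {x} [] _ = x , x , (λ _ → inj₁ refl) ∷ []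
  nonExits-atMostTwo S⇒¬exit {x} {z} (e ∷ w) shortest =
    x , z , (λ _ → inj₁ refl) ∷ All.map endpoint (interior-exits e w shortest)
    where
    endpoint : ∀ {v} → IsExit v ⊎ v ≡ z → _ → v ≡ x ⊎ v ≡ z
    endpoint (inj₁ exit) Sv = ⊥-elim (S⇒¬exit Sv exit)
    endpoint (inj₂ v≡z)  _  = inj₂ v≡z

  walk-within-copy : ∀ g h h′ → ∃ λ k → k ≤ 1 × Walk E (g , h) (g , h′) k
  walk-within-copy g h h′ with h ≟ h′
  ... | yes refl = 0 , z≤n , []
  ... | no h≢h′  = 1 , ≤-refl , inj₁ (refl , h≢h′) ∷ []

  walk≤3 : ∀ x y → ∃ λ k → k ≤ 3 × Walk E x y k
  walk≤3 (g , h) (g′ , h′) with g ≟ g′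
  ... | yes refl with k , k≤1 , w ← walk-within-copy g h h′ = k , ≤-trans k≤1 (s≤s z≤n) , w
  ... | no g≢g′
    with k , k≤1 , w ← walk-within-copy g h (f g′)
       | l , l≤1 , w′ ← walk-within-copy g′ (f g) h′
       = k + suc l , +-mono-≤ k≤1 (s≤s l≤1) , w ++ᵂ (inj₂ (g≢g′ , refl , refl) ∷ w′)

  shortest⇒length≤3 : ∀ {x y k} (w : Walk E x y k) → IsShortest E w → k ≤ 3
  shortest⇒length≤3 {x} {y} _ shortest with _ , l≤3 , w′ ← walk≤3 x y = ≤-trans (shortest w′) l≤3

  module Injective (f-injective : Injective _≡_ _≡_ f) where

    cross-cross⇒≡ : ∀ {x y z} → Cross x y → Cross y z → x ≡ z
    cross-cross⇒≡ (_ , h≡fg′ , h′≡fg) (_ , h′≡fg″ , h″≡fg′) =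
      cong₂ _,_ (f-injective (trans (sym h′≡fg) h′≡fg″)) (trans h≡fg′ (sym h″≡fg′))

    short-walk-between-copies : ∀ {x y k} → Walk E x y k → k ≤ 2 → proj₁ x ≢ proj₁ y →
                                proj₂ x ≡ f (proj₁ y) ⊎ proj₂ y ≡ f (proj₁ x)
    short-walk-between-copies [] _ x≁y = ⊥-elim (x≁y refl)
    short-walk-between-copies (inj₁ (x~y , _) ∷ []) _ x≁y = ⊥-elim (x≁y x~y)
    short-walk-between-copies (inj₂ (_ , h≡ , _) ∷ []) _ _ = inj₁ h≡
    short-walk-between-copies (inj₁ (x~ , _) ∷ inj₁ (~y , _) ∷ []) _ x≁y = ⊥-elim (x≁y (trans x~ ~y))
    short-walk-between-copies (inj₁ (x~ , _) ∷ inj₂ (_ , _ , h≡) ∷ []) _ _ = inj₂ (trans h≡ (cong f (sym x~)))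
    short-walk-between-copies (inj₂ (_ , h≡ , _) ∷ inj₁ (~y , _) ∷ []) _ _ = inj₁ (trans h≡ (cong f ~y))
    short-walk-between-copies (inj₂ c₁ ∷ inj₂ c₂ ∷ []) _ x≁y =
      ⊥-elim (x≁y (cong proj₁ (cross-cross⇒≡ c₁ c₂)))
    short-walk-between-copies (_ ∷ _ ∷ _ ∷ _) (s≤s (s≤s ()))

    bridge : ∀ {g g′ u v} → g ≢ g′ → u ≢ f g′ → v ≢ f g → Walk E (g , u) (g′ , v) 3
    bridge g≢g′ u≢fg′ v≢fg =
      inj₁ (refl , u≢fg′) ∷ inj₂ (g≢g′ , refl , refl) ∷ inj₁ (refl , v≢fg ∘ sym) ∷ []

    bridge-shortest : ∀ {g g′ u v} (g≢g′ : g ≢ g′) (u≢fg′ : u ≢ f g′) (v≢fg : v ≢ f g) →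
                      IsShortest E (bridge g≢g′ u≢fg′ v≢fg)
    bridge-shortest g≢g′ u≢fg′ v≢fg {k} w with k ≤? 2
    ... | no k≰2 = ≰⇒> k≰2
    ... | yes k≤2 with short-walk-between-copies w k≤2 g≢g′
    ...   | inj₁ u≡fg′ = ⊥-elim (u≢fg′ u≡fg′)
    ...   | inj₂ v≡fg  = ⊥-elim (v≢fg v≡fg)

    generalPosition⇒¬bridge : ∀ {X g g′ u v} → IsGeneralPosition E X → g ≢ g′ → u ≢ f g′ → v ≢ f g →
                              (g , u) ∈ X → (g , f g′) ∈ X → (g′ , v) ∈ X → ⊥
    generalPosition⇒¬bridge X-gp g≢g′ u≢fg′ v≢fg u∈X fg′∈X v∈X =
      X-gp (bridge g≢g′ u≢fg′ v≢fg) (bridge-shortest g≢g′ u≢fg′ v≢fg)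
        ( _ , _ , _ , u≢fg′ ∘ cong proj₂ , g≢g′ ∘ cong proj₁ , g≢g′ ∘ cong proj₁
        , u∈X , fg′∈X , v∈X , here refl , there (here refl) , there (there (there (here refl))))

    module _ {S : Vertex → Set} (S? : Decidable S) (c : Fin m) (S-avoids-c : ∀ {h} → ¬ S (c , h))
             (S-crosses-into-c : ∀ {x y} → Cross x y → S x → proj₁ y ≡ c) where

      private
        ¬S-in-c : ∀ {v} → proj₁ v ≡ c → ¬ S v
        ¬S-in-c refl = S-avoids-c

        cross-atMostOne : ∀ {x y} → Cross x y → ∃ λ a → All (λ v → S v → v ≡ a) (x ∷ y ∷ [])
        cross-atMostOne {x} {y} xy with S? x
        ... | yes Sx = x , (λ _ → refl) ∷ (λ Sy → ⊥-elim (¬S-in-c (S-crosses-into-c xy Sx) Sy)) ∷ []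
        ... | no ¬Sx = y , (λ Sx → ⊥-elim (¬Sx Sx)) ∷ (λ _ → refl) ∷ []

        inner-cross-inner : ∀ {p₀ p₁ p₂ p₃} → Inner p₀ p₁ → Cross p₁ p₂ → Inner p₂ p₃ →
                            AtMostTwo S (p₀ ∷ p₁ ∷ p₂ ∷ p₃ ∷ [])
        inner-cross-inner {p₀} {p₁} {p₂} {p₃} (p₀~p₁ , _) c₁₂ (p₂~p₃ , _) with S? p₁ | S? p₂
        ... | yes S₁ | _      =
          p₀ , p₁ , (λ _ → inj₁ refl) ∷ (λ _ → inj₂ refl)
                  ∷ (λ S₂ → ⊥-elim (¬S-in-c (S-crosses-into-c c₁₂ S₁) S₂))
                  ∷ (λ S₃ → ⊥-elim (¬S-in-c (trans (sym p₂~p₃) (S-crosses-into-c c₁₂ S₁)) S₃)) ∷ []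
        ... | no ¬S₁ | yes S₂ =
          p₂ , p₃ , (λ S₀ → ⊥-elim (¬S-in-c (trans p₀~p₁ (S-crosses-into-c (Cross-sym c₁₂) S₂)) S₀))
                  ∷ (λ S₁ → ⊥-elim (¬S₁ S₁)) ∷ (λ _ → inj₁ refl) ∷ (λ _ → inj₂ refl) ∷ []
        ... | no ¬S₁ | no ¬S₂ =
          p₀ , p₃ , (λ _ → inj₁ refl) ∷ (λ S₁ → ⊥-elim (¬S₁ S₁)) ∷ (λ S₂ → ⊥-elim (¬S₂ S₂))
                  ∷ (λ _ → inj₂ refl) ∷ []

      crossingInto-atMostTwo : ∀ {x z k} (w : Walk E x z k) → IsShortest E w → AtMostTwo S (verts w)
      crossingInto-atMostTwo {x} [] _ = x , x , (λ _ → inj₁ refl) ∷ []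
      crossingInto-atMostTwo {x} {z} (_ ∷ []) _ = x , z , (λ _ → inj₁ refl) ∷ (λ _ → inj₂ refl) ∷ []
      crossingInto-atMostTwo {x} {z} (e₁ ∷ e₂ ∷ []) shortest with shortest⇒cross e₁ e₂ [] shortest
      ... | inj₁ c₀₁ with a , one ← cross-atMostOne c₀₁ =
        a , z , All.++⁺ (All.map (inj₁ ∘_) one) ((λ _ → inj₂ refl) ∷ [])
      ... | inj₂ c₁₂ with a , one ← cross-atMostOne c₁₂ =
        x , a , (λ _ → inj₁ refl) ∷ All.map (inj₂ ∘_) one
      crossingInto-atMostTwo (inj₁ i₁ ∷ inj₁ i₂ ∷ e₃ ∷ []) shortest =
        ⊥-elim (no-shortcut (inj₁ i₁) (inj₁ i₂) (e₃ ∷ []) shortest (inner-inner⇒shortcut i₁ i₂))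
      crossingInto-atMostTwo (inj₂ c₁ ∷ inj₂ c₂ ∷ e₃ ∷ []) shortest =
        ⊥-elim (no-shortcut (inj₂ c₁) (inj₂ c₂) (e₃ ∷ []) shortest (inj₁ (cross-cross⇒≡ c₁ c₂)))
      crossingInto-atMostTwo (e₁ ∷ inj₁ i₂ ∷ inj₁ i₃ ∷ []) shortest =
        ⊥-elim (no-shortcut (inj₁ i₂) (inj₁ i₃) [] (shortest-tail e₁ (inj₁ i₂ ∷ inj₁ i₃ ∷ []) shortest)
                            (inner-inner⇒shortcut i₂ i₃))
      crossingInto-atMostTwo (e₁ ∷ inj₂ c₂ ∷ inj₂ c₃ ∷ []) shortest =
        ⊥-elim (no-shortcut (inj₂ c₂) (inj₂ c₃) [] (shortest-tail e₁ (inj₂ c₂ ∷ inj₂ c₃ ∷ []) shortest)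
                            (inj₁ (cross-cross⇒≡ c₂ c₃)))
      crossingInto-atMostTwo (inj₁ i₁ ∷ inj₂ c₂ ∷ inj₁ i₃ ∷ []) _ = inner-cross-inner i₁ c₂ i₃
      crossingInto-atMostTwo (inj₂ c₁ ∷ inj₁ _ ∷ inj₂ c₃ ∷ []) _
        with a , one ← cross-atMostOne c₁ | b , other ← cross-atMostOne c₃ =
        a , b , All.++⁺ (All.map (inj₁ ∘_) one) (All.map (inj₂ ∘_) other)
      crossingInto-atMostTwo w@(_ ∷ _ ∷ _ ∷ _ ∷ _) shortest
        with s≤s (s≤s (s≤s ())) ← shortest⇒length≤3 w shortest

-- The lower bound

module _ {m n : ℕ} (f : Fin (suc m) → Fin n) where
  open SierpinskiComplete f

  nonExits-per-copy : ∀ g → n ∸ m ≤ count (λ h → ∁? exit? (g , h))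
  nonExits-per-copy g = begin
    n ∸ m                            ≡⟨ cong (n ∸_) (count-≢ g) ⟨
    n ∸ count (∁? (_≟ g))            ≤⟨ ∸-monoʳ-≤ n (count-image f (∁? (_≟ g))) ⟩
    n ∸ count (λ h → exit? (g , h))  ≡⟨ count-∁ (λ h → exit? (g , h)) ⟨
    count (λ h → ∁? exit? (g , h))   ∎
    where open ≤-Reasoning

  nonExitsAvoiding-per-copy : ∀ {g c} → g ≢ c → suc n ∸ m ≤ count (λ h → ∁? (exitAvoiding? c) (g , h))
  nonExitsAvoiding-per-copy {g} {c} g≢c = begin
    suc n ∸ m                                   ≡⟨ cong (suc n ∸_) (count-≢ g) ⟨
    suc n ∸ count (∁? (_≟ g))                   ≤⟨ ∸-monoʳ-≤ (suc n) fewer-exits ⟩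
    n ∸ count (λ h → exitAvoiding? c (g , h))   ≡⟨ count-∁ (λ h → exitAvoiding? c (g , h)) ⟨
    count (λ h → ∁? (exitAvoiding? c) (g , h))  ∎
    where
    open ≤-Reasoning
    fewer-exits : count (λ h → exitAvoiding? c (g , h)) < count (∁? (_≟ g))
    fewer-exits = ≤-trans (s≤s (count-image f (∁? (_≟ g) ∩? ∁? (_≟ c))))
      (count-<-mono (∁? (_≟ g) ∩? ∁? (_≟ c)) (∁? (_≟ g)) proj₁ (g≢c ∘ sym) (λ (_ , c≢c) → c≢c refl))

collision? : (f : Fin m → Fin n) → Dec (∃₂ λ a b → a ≢ b × f a ≡ f b)
collision? f = any? λ a → any? λ b → ¬? (a ≟ b) ×-dec (f a ≟ f b)

no-collision⇒injective : {f : Fin m → Fin n} → ¬ (∃₂ λ a b → a ≢ b × f a ≡ f b) → Injective _≡_ _≡_ f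
no-collision⇒injective none {a} {b} fa≡fb with a ≟ b
... | yes a≡b = a≡b
... | no  a≢b = ⊥-elim (none (a , b , a≢b , fa≡fb))

enumerate-generalPosition : ∀ {E : Fin m × Fin n → Fin m × Fin n → Set} {S : Fin m × Fin n → Set} →
  (S? : Decidable S) → (∀ {u v k} (w : Walk E u v k) → IsShortest E w → AtMostTwo S (verts w)) →
  ∀ {k} → k ≤ ∑[ g < m ] count (λ h → S? (g , h)) →
  ∃ λ X → Unique X × IsGeneralPosition E X × k ≤ length X
enumerate-generalPosition {m} {n} S? atMostTwo k≤ =
  filter S? grid , filter⁺ S? {grid} (grid-unique {m} {n}) ,
  atMostTwo⇒generalPosition atMostTwo (proj₂ ∘ ∈-filter⁻ S? {xs = grid}) ,
  subst (_ ≤_) (sym (length-filter-grid S?)) k≤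

module _ (f : Fin 6 → Fin 9) where
  open SierpinskiComplete f

  nonExits-≥25 : ∀ {a b} → a ≢ b → f a ≡ f b → (∃ λ g₀ → g₀ ≢ b × g₀ ≢ a) →
                 25 ≤ ∑[ g < 6 ] count (λ h → ∁? exit? (g , h))
  nonExits-≥25 {a} {b} a≢b fa≡fb (g₀ , g₀≢b , g₀≢a) = begin
    25                                         ≡⟨ cong (24 +_) (count-≡ g₀) ⟨
    24 + count (_≟ g₀)                         ≡⟨ ∑-distrib-+ (λ _ → 4) (𝟙 ∘ (_≟ g₀)) ⟨
    ∑[ g < 6 ] (4 + 𝟙 (g ≟ g₀))               ≤⟨ sum-mono-≤ per-copy ⟩
    ∑[ g < 6 ] count (λ h → ∁? exit? (g , h))  ∎
    where
    open ≤-Reasoning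
    exit⇒exitAvoiding : ∀ {h} → IsExit (g₀ , h) → ExitAvoiding b (g₀ , h)
    exit⇒exitAvoiding (k , k≢g₀ , fk≡h) with k ≟ b
    ... | yes refl = a , (g₀≢a ∘ sym , a≢b) , trans fa≡fb fk≡h
    ... | no k≢b   = k , (k≢g₀ , k≢b) , fk≡h
    per-copy : ∀ g → 4 + 𝟙 (g ≟ g₀) ≤ count (λ h → ∁? exit? (g , h))
    per-copy g with g ≟ g₀
    ... | no _     = nonExits-per-copy f g
    ... | yes refl = ≤-trans (nonExitsAvoiding-per-copy f g₀≢b)
                             (count-mono (λ h → ∁? (exitAvoiding? b) (g₀ , h)) (λ h → ∁? exit? (g₀ , h))
                                         (λ ¬avoiding → ¬avoiding ∘ exit⇒exitAvoiding))

  exitsOnlyTo-zero-≥25 : 25 ≤ ∑[ g < 6 ] count (λ h → exitsOnlyTo? zero (g , h))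
  exitsOnlyTo-zero-≥25 = sum-mono-≤ per-copy
    where
    per-copy : ∀ g → 𝟙 (¬? (g ≟ zero)) * 5 ≤ count (λ h → exitsOnlyTo? zero (g , h))
    per-copy zero    = z≤n
    per-copy (suc g) = nonExitsAvoiding-per-copy f {suc g} {zero} λ ()

large-generalPosition-set : (f : Fin 6 → Fin 9) →
  ∃ λ X → Unique X × IsGeneralPosition (Sierpinski (K 6) (K 9) f) X × 25 ≤ length X
large-generalPosition-set f with collision? f
... | yes (a , b , a≢b , fa≡fb) =
  enumerate-generalPosition (∁? exit?) (nonExits-atMostTwo (λ ¬exit → ¬exit))
    (nonExits-≥25 f a≢b fa≡fb (avoid-two a b))
  where open SierpinskiComplete f
... | no no-collision =
  enumerate-generalPosition (exitsOnlyTo? zero)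
    (crossingInto-atMostTwo (exitsOnlyTo? zero) zero (λ (0≢0 , _) → 0≢0 refl) exitsOnlyTo-crosses-into)
    (exitsOnlyTo-zero-≥25 f)
  where
  open SierpinskiComplete f
  open Injective (no-collision⇒injective no-collision)

-- The upper bound for the inclusion Fin 6 ↪ Fin 9

big-copies-bound : ∀ {k} → k ≤ 6 → 4 * k + (6 ∸ k) * (2 ⊔ k) ≤ 25
big-copies-bound {k} k≤6 =
  subst (λ j → 4 * j + (6 ∸ j) * (2 ⊔ j) ≤ 25) (toℕ-fromℕ< (s≤s k≤6)) (checked (fromℕ< (s≤s k≤6)))
  where
  checked : ∀ (j : Fin 7) → 4 * toℕ j + (6 ∸ toℕ j) * (2 ⊔ toℕ j) ≤ 25
  checked = from-yes (all? λ (j : Fin 7) → 4 * toℕ j + (6 ∸ toℕ j) * (2 ⊔ toℕ j) ≤? 25)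

ι : Fin 6 → Fin 9
ι = _↑ˡ 3

module _ (X : List (Fin 6 × Fin 9)) (X-unique : Unique X)
         (X-gp : IsGeneralPosition (Sierpinski (K 6) (K 9) ι) X) where

  open SierpinskiComplete ι
  open Injective (λ {g} {g′} → ↑ˡ-injective 3 g g′)
  open import Data.List.Membership.DecPropositional (≡-dec (_≟_ {6}) (_≟_ {9})) using (_∈?_)

  private
    inX? : ∀ g → Decidable (λ h → (g , h) ∈ X)
    inX? g h = (g , h) ∈? X

    size : Fin 6 → ℕ
    size g = count (inX? g)

    big? : ∀ g → Dec (2 ≤ size g)
    big? g = 2 ≤? size g

    Points : Fin 6 → Fin 6 → Set
    Points g g′ = 2 ≤ size g × g′ ≢ g × (g , ι g′) ∈ X

    points? : ∀ g g′ → Dec (Points g g′)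
    points? g g′ = big? g ×-dec ¬? (g′ ≟ g) ×-dec inX? g (ι g′)

    small : Fin 6 → ℕ
    small g = 𝟙 (¬? (big? g))

    outgoing incoming : Fin 6 → ℕ
    outgoing g  = count (points? g)
    incoming g′ = count (λ g → points? g g′)

    bigCount : ℕ
    bigCount = count big?

  length≤∑size : length X ≤ ∑[ g < 6 ] size g
  length≤∑size = subst (length X ≤_) (length-filter-grid (_∈? X))
    (unique-⊆⇒length≤ X-unique (λ {x} x∈X → ∈-filter⁺ (_∈? X) (∈-grid x) x∈X))

  pointed-copy-only-at-ι : ∀ {g g′ v} → Points g g′ → (g′ , v) ∈ X → v ≡ ι g
  pointed-copy-only-at-ι {g} {g′} {v} (big , g′≢g , ιg′∈X) v∈X with v ≟ ι g
  ... | yes v≡ιg = v≡ιg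
  ... | no  v≢ιg =
    let u , u≢ιg′ , u∈X = count≥2⇒∃≢ (inX? g) big (ι g′)
    in ⊥-elim (generalPosition⇒¬bridge X-gp (g′≢g ∘ sym) u≢ιg′ v≢ιg u∈X ιg′∈X v∈X)

  pointed⇒small : ∀ {g g′} → Points g g′ → size g′ ≤ 1
  pointed⇒small p = count-≤1 (inX? _) λ v∈X v′∈X →
    trans (pointed-copy-only-at-ι p v∈X) (sym (pointed-copy-only-at-ι p v′∈X))

  big⇒size≤4+pointers : ∀ {g} → 2 ≤ size g → size g ≤ 4 + outgoing g
  big⇒size≤4+pointers {g} big = begin
    size g                                               ≡⟨ sum-↑ 6 (𝟙 ∘ inX? g) ⟩
    count (inX? g ∘ ι) + ∑[ i < 3 ] 𝟙 (inX? g (6 ↑ʳ i))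
      ≤⟨ +-mono-≤ (count≤1+count-≢ (inX? g ∘ ι) g) (count≤n (λ i → inX? g (6 ↑ʳ i))) ⟩
    1 + count (∁? (_≟ g) ∩? (inX? g ∘ ι)) + 3
      ≤⟨ +-monoˡ-≤ 3 (s≤s (count-mono (∁? (_≟ g) ∩? (inX? g ∘ ι)) (points? g) (big ,_))) ⟩
    1 + outgoing g + 3                                   ≡⟨ +-comm (1 + outgoing g) 3 ⟩
    4 + outgoing g                                       ∎
    where open ≤-Reasoning

  size-bound : ∀ g → size g ≤ 4 * 𝟙 (big? g) + (small g * size g + outgoing g)
  size-bound g = by-cases (big? g)
    where
    -- not `with big? g`: that would also abstract the occurrences of big? g inside points? g
    by-cases : (d : Dec (2 ≤ size g)) → size g ≤ 4 * 𝟙 d + (𝟙 (¬? d) * size g + outgoing g)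
    by-cases (yes big) = big⇒size≤4+pointers big
    by-cases (no _)    = ≤-trans (≤-reflexive (sym (*-identityˡ (size g)))) (m≤m+n _ _)

  incoming-bound : ∀ g′ → small g′ * size g′ + incoming g′ ≤ small g′ * (2 ⊔ bigCount)
  incoming-bound g′ = by-cases (big? g′)
    where
    small-target : size g′ ≤ 1 → size g′ + incoming g′ ≤ 2 ⊔ bigCount
    small-target small′ with any? (inX? g′)
    ... | no empty = begin
      size g′ + incoming g′  ≡⟨ cong (_+ incoming g′) (count-none (inX? g′) (λ v v∈X → empty (v , v∈X))) ⟩
      incoming g′            ≤⟨ count-mono (λ g → points? g g′) big? proj₁ ⟩
      bigCount               ≤⟨ m≤n⊔m 2 bigCount ⟩
      2 ⊔ bigCount           ∎
      where open ≤-Reasoning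
    ... | yes (v , v∈X) = begin
      size g′ + incoming g′  ≤⟨ +-mono-≤ small′ single-pointer ⟩
      2                      ≤⟨ m≤m⊔n 2 bigCount ⟩
      2 ⊔ bigCount           ∎
      where
      open ≤-Reasoning
      single-pointer : incoming g′ ≤ 1
      single-pointer = count-≤1 (λ g → points? g g′) λ p p′ →
        ↑ˡ-injective 3 _ _ (trans (sym (pointed-copy-only-at-ι p v∈X)) (pointed-copy-only-at-ι p′ v∈X))

    by-cases : (d : Dec (2 ≤ size g′)) → 𝟙 (¬? d) * size g′ + incoming g′ ≤ 𝟙 (¬? d) * (2 ⊔ bigCount)
    by-cases (yes big′)  = ≤-reflexive (count-none (λ g → points? g g′) (λ _ p → <⇒≱ big′ (pointed⇒small p)))
    by-cases (no small′) =
      subst₂ _≤_ (cong (_+ incoming g′) (sym (*-identityˡ (size g′)))) (sym (*-identityˡ (2 ⊔ bigCount)))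
             (small-target (s≤s⁻¹ (≰⇒> small′)))

  generalPosition-ι-≤25 : length X ≤ 25
  generalPosition-ι-≤25 = begin
    length X
      ≤⟨ length≤∑size ⟩
    ∑[ g < 6 ] size g
      ≤⟨ sum-mono-≤ size-bound ⟩
    ∑[ g < 6 ] (4 * 𝟙 (big? g) + (small g * size g + outgoing g))
      ≡⟨ ∑-distrib-+ (λ g → 4 * 𝟙 (big? g)) (λ g → small g * size g + outgoing g) ⟩
    ∑[ g < 6 ] (4 * 𝟙 (big? g)) + ∑[ g < 6 ] (small g * size g + outgoing g)
      ≡⟨ cong₂ _+_ (sym (*-distribˡ-sum 4 (𝟙 ∘ big?))) (∑-distrib-+ (λ g → small g * size g) outgoing) ⟩
    4 * k + (∑[ g < 6 ] (small g * size g) + ∑[ g < 6 ] outgoing g)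
      ≡⟨ cong (λ t → 4 * k + (∑[ g < 6 ] (small g * size g) + t)) (∑-comm (λ g g′ → 𝟙 (points? g g′))) ⟩
    4 * k + (∑[ g < 6 ] (small g * size g) + ∑[ g < 6 ] incoming g)
      ≡⟨ cong (4 * k +_) (∑-distrib-+ (λ g → small g * size g) incoming) ⟨
    4 * k + ∑[ g < 6 ] (small g * size g + incoming g)
      ≤⟨ +-monoʳ-≤ (4 * k) (sum-mono-≤ incoming-bound) ⟩
    4 * k + ∑[ g < 6 ] (small g * (2 ⊔ k))
      ≡⟨ cong (4 * k +_) (*-distribʳ-sum (2 ⊔ k) small) ⟨
    4 * k + count (∁? big?) * (2 ⊔ k)
      ≡⟨ cong (λ t → 4 * k + t * (2 ⊔ k)) (count-∁ big?) ⟩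
    4 * k + (6 ∸ k) * (2 ⊔ k)
      ≤⟨ big-copies-bound (count≤n big?) ⟩
    25 ∎
    where
    open ≤-Reasoning
    k = bigCount

proposition5p4 : IsLowerGpS (K 6) (K 9) 25
proposition5p4 = (ι , gp-ι) , gp≥25
  where
  gp-ι : IsGp (Sierpinski (K 6) (K 9) ι) 25
  gp-ι =
    let X , X-unique , X-gp , 25≤|X| = large-generalPosition-set ι
    in (X , X-unique , X-gp , ≤-antisym (generalPosition-ι-≤25 X X-unique X-gp) 25≤|X|) , generalPosition-ι-≤25

  gp≥25 : ∀ f k → IsGp (Sierpinski (K 6) (K 9) f) k → 25 ≤ k
  gp≥25 f k (_ , maximal) =
    let X , X-unique , X-gp , 25≤|X| = large-generalPosition-set f
    in ≤-trans 25≤|X| (maximal X X-unique X-gp)
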